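{- The decompressor $U$ defined below is universal, i.e. for every partial computable $W:\{0,1\}^*\to\{0,1\}^*$ there is a constant $c$ with $\mathrm{C}_U(x)\le \mathrm{C}_W(x)+c$ for all $x$.
   Context: Let $V$ be a universal conditional decompressor (partial computable $V(d,y)$, optimal up to an additive constant) such that $\mathrm{C}_V(x\mid y)=\min\{|d|:V(d,y)=x\}$ is even for all $x,y$; write $V(d)=V(d,\text{empty word})$ and $\mathrm{C}_V(x)=\mathrm{C}_V(x\mid \text{empty word})$. Let $D$ be a fixed positive integer constant, and let $G$ be a constant such that for every string $x$, $\mathrm{C}_V(x)\ge|x|-D$ implies $\mathrm{C}_V(x0^9)\ge |x|+9-G$. An odd number $m$ is called specific if $m=p\cdot u$ with $p$ prime and $u<p$; $p$ is then called its large prime divider. $p_l$ denotes the $l$-th prime, and $H$ is the Halting problem (set of programs halting on the empty input). For a $k\times n$ binary matrix $A$ and strings, $A\cdot s$ denotes concatenation of $A$ (written as a string of $nk$ bits) with $s$, and $Ay$ the product over $\mathbb{F}_2$. Define $U(d)$ for $d\in\{0,1\}^*$: (1) If $d=1^{D-1}0d'$: run $V(d')$; if undefined, $U(d)$ is undefined; otherwise let $y=V(d')$. If $y$ is not of the form $y'0^9$ with $|y'|$ specific, set $U(d)=y$. Otherwise, if $|y|>|d'|-G$ set $U(d)=y$, else $U(d)$ is undefined. (2) If $d=1^D0d'$, then $U(d)=d'$. (3) If $d=0d'$ and $|d'|+5$ is specific with large prime divider $p_l$, write $|d'|=p_l k-5$, $n=p_l-1$, and $d'=A\cdot d''$ with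 $A$ a $k\times n$ matrix and $|d''|=k-5$. Run $V(d''\mid n)$; if it halts with output $y$ with $|y|=n$, let $x$ be the first $l$ bits of $y$; if $x\in H$ then $U(d)=A\cdot Ay\cdot 0^9$. In all other cases $U(d)$ is undefined. -}

module Defs where

open import Data.Bool using (Bool; true; false; _xor_; _∧_; if_then_else_)
open import Data.Nat using (ℕ; zero; suc; _+_; _*_; _∸_; _<_; _≤_; _≡ᵇ_; _%_; _/_)
open import Data.Nat.Primality using (Prime; prime?)
open import Data.Integer as ℤ using (ℤ; +_)
open import Data.List using (List; []; _∷_; _++_; replicate; length; take; drop; map; reverse; filter; upTo; concatMap; foldr; zipWith)
open import Data.Maybe using (Maybe; just; nothing)
open import Data.Product using (Σ; ∃; _×_; _,_)
open import Data.Sum using (_⊎_)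
open import Relation.Nullary using (¬_)
open import Relation.Binary.PropositionalEquality using (_≡_)
open import Relation.Binary.Construct.Closure.ReflexiveTransitive using (Star)

Str : Set
Str = List Bool

-- bijective numbering of binary strings: ε ↦ 0, b ∷ s ↦ 1 + b + 2·code s
code : Str → ℕ
code []      = 0
code (b ∷ s) = suc ((if b then 1 else 0) + 2 * code s)

zeros9 : Str
zeros9 = replicate 9 false

-- standard binary representation (most significant bit first) of a number,
-- used to give n as condition to V;  bin 0 = "0"
binRev : ℕ → ℕ → Str          -- fuel, number (least significant bit first)
binRev zero    n = []
binRev (suc f) zero = []
binRev (suc f) (suc m) = ((suc m % 2) ≡ᵇ 1) ∷ binRev f (suc m / 2)

bin : ℕ → Str
bin zero    = false ∷ []
bin (suc m) = reverse (binRev (suc m) (suc m))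

-- Model of computation: counter (Minsky) machines.
-- A partial computable function of one (two) string argument(s) is the
-- input/output relation of such a machine.

data Instr : Set where
  INC : ℕ → Instr
  DEC : ℕ → ℕ → Instr

Program : Set
Program = List Instr

fetch : Program → ℕ → Maybe Instr
fetch []      _       = nothing
fetch (i ∷ P) zero    = just i
fetch (i ∷ P) (suc n) = fetch P n

Regs : Set
Regs = ℕ → ℕ

update : Regs → ℕ → ℕ → Regs
update R r v k = if k ≡ᵇ r then v else R k

State : Set
State = ℕ × Regs

data Step (P : Program) : State → State → Set where
  inc  : ∀ {pc R r} → fetch P pc ≡ just (INC r) →
         Step P (pc , R) (suc pc , update R r (suc (R r)))
  decZ : ∀ {pc R r j} → fetch P pc ≡ just (DEC r j) → R r ≡ 0 →
         Step P (pc , R) (j , R)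
  decS : ∀ {pc R r j v} → fetch P pc ≡ just (DEC r j) → R r ≡ suc v →
         Step P (pc , R) (suc pc , update R r v)

init : ℕ → ℕ → Regs
init a b zero          = a
init a b (suc zero)    = b
init a b (suc (suc _)) = 0

Runs : Program → Regs → Regs → Set
Runs P R0 R = Σ ℕ λ pc → Star (Step P) (0 , R0) (pc , R) × fetch P pc ≡ nothing

Out₁ : Program → Str → Str → Set
Out₁ P d x = Σ Regs λ R → Runs P (init (code d) 0) R × R 0 ≡ code x

Out₂ : Program → Str → Str → Str → Set
Out₂ P d y x = Σ Regs λ R → Runs P (init (code d) (code y)) R × R 0 ≡ code x

-- programs as strings (prefix-free encoding)
unary : ℕ → Str
unary r = replicate r true ++ (false ∷ [])

encInstr : Instr → Str
encInstr (INC r)   = false ∷ unary r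
encInstr (DEC r j) = true ∷ (unary r ++ unary j)

encode : Program → Str
encode = concatMap encInstr

H : Str → Set
H x = Σ Program λ P → encode P ≡ x × Σ Regs λ R → Runs P (init (code []) 0) R

Odd : ℕ → Set
Odd m = m % 2 ≡ 1

SpecificWith : ℕ → ℕ → ℕ → Set
SpecificWith m p u = Odd m × Prime p × u < p × m ≡ p * u

Specific : ℕ → Set
Specific m = Σ ℕ λ p → Σ ℕ λ u → SpecificWith m p u

-- p is the l-th prime (p_1 = 2): p is prime and exactly l primes are ≤ p
IsNthPrime : ℕ → ℕ → Set
IsNthPrime l p = Prime p × length (filter prime? (upTo (suc p))) ≡ l

-- Matrices over F₂: a k×n matrix is written row-major as a string of nk bits

rows : ℕ → ℕ → Str → List Str
rows zero    n a = []
rows (suc k) n a = take n a ∷ rows k n (drop n a)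

dot : Str → Str → Bool
dot u v = foldr _xor_ false (zipWith _∧_ u v)

mulMat : ℕ → ℕ → Str → Str → Str
mulMat k n a y = map (λ row → dot row y) (rows k n a)

module _ (V : Program) (D : ℕ) (G : ℤ) where

  V₀ : Str → Str → Set
  V₀ d y = Out₂ V d [] y

  SpecPadded : Str → Set
  SpecPadded y = Σ Str λ y' → y ≡ y' ++ zeros9 × Specific (length y')

  Rule1 : Str → Str → Set
  Rule1 d y = Σ Str λ d' → d ≡ replicate (D ∸ 1) true ++ (false ∷ d') × V₀ d' y ×
      (¬ SpecPadded y ⊎ (SpecPadded y × (+ length d') ℤ.- G ℤ.< + length y))

  Rule2 : Str → Str → Set
  Rule2 d y = Σ Str λ d' → d ≡ replicate D true ++ (false ∷ d') × y ≡ d'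

  Rule3 : Str → Str → Set
  Rule3 d y =
    ¬ (Σ Str λ e → d ≡ replicate (D ∸ 1) true ++ (false ∷ e)) ×
    (Σ Str λ d' → d ≡ false ∷ d' ×
     Σ ℕ λ p → Σ ℕ λ k → Σ ℕ λ l → SpecificWith (length d' + 5) p k × IsNthPrime l p ×
     Σ Str λ a → Σ Str λ d'' → d' ≡ a ++ d'' × length a ≡ (p ∸ 1) * k × length d'' + 5 ≡ k ×
     Σ Str λ y' → Out₂ V d'' (bin (p ∸ 1)) y' × length y' ≡ p ∸ 1 ×
     H (take l y') × y ≡ a ++ (mulMat k (p ∸ 1) a y' ++ zeros9))

  UOut : Str → Str → Set
  UOut d y = Rule1 d y ⊎ Rule2 d y ⊎ Rule3 d y

UniversalCond : Program → Set
UniversalCond V = ∀ (W : Program) → Σ ℕ λ c → ∀ d y x → Out₂ W d y x →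
  Σ Str λ d' → Out₂ V d' y x × length d' ≤ length d + c

EvenComplexity : Program → Set
EvenComplexity V = ∀ x y d → Out₂ V d y x →
  (∀ d' → Out₂ V d' y x → length d ≤ length d') → length d % 2 ≡ 0

PaddingConst : Program → ℕ → ℤ → Set
PaddingConst V D G = ∀ x →
  (∀ d → Out₂ V d [] x → + length x ℤ.- + D ℤ.≤ + length d) →
  (∀ d → Out₂ V d [] (x ++ zeros9) → + length x ℤ.+ + 9 ℤ.- G ℤ.≤ + length d)

-- Translate a W-description d of x into a V-description e with |e| ≤ |d| + c.
-- If |x| > |e| − G, rule 1 applied to e already describes x in |e| + D bits.
-- Otherwise x is short, |x| ≤ |e| + |G|, and the literal description of
-- rule 2 costs |x| + D + 1 bits. Either way the overhead is a constant.
module Submission where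

open import Defs
open import Data.Nat using (ℕ; _+_; _≤_; _<_)
open import Data.Integer using (ℤ)
open import Data.List using (length)
open import Data.Product using (Σ; _×_)

open import Data.Bool using (true; false)
import Data.Bool.Properties as Bool
open import Data.Integer as ℤ using (+_; ∣_∣)
import Data.Integer.Properties as ℤ
open import Data.List as List using ([]; _∷_; _++_; replicate)
open import Data.List.Properties using (length-++; length-replicate; ++-cancelʳ)
open import Data.List.Relation.Binary.Pointwise using (Pointwise-≡⇒≡; ≡⇒Pointwise-≡)
open import Data.List.Relation.Binary.Suffix.Heterogeneous as Suffix
  using (Suffix; toView; _++ˢ_)
open import Data.List.Relation.Binary.Suffix.Heterogeneous.Properties using (suffix?)
open import Data.Nat as ℕ using (suc; _∸_; _*_; _≟_; _<?_; s≤s; anyUpTo?)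
open import Data.Nat.Primality using (prime?)
open import Data.Nat.Properties as ℕ using (≤-trans; +-mono-≤; +-monoʳ-≤; +-monoˡ-≤; m≤m+n)
open import Data.Nat.Tactic.RingSolver using (solve-∀)
open import Data.Product using (_,_)
open import Data.Sum using (inj₁; inj₂)
open import Relation.Nullary using (Dec; yes; no; ¬_)
open import Relation.Nullary.Decidable using (_×-dec_)
open import Relation.Binary.PropositionalEquality using (_≡_; refl; sym; trans; cong; subst)

specificWith? : ∀ m p u → Dec (SpecificWith m p u)
specificWith? m p u = ((m ℕ.% 2) ≟ 1) ×-dec (prime? p ×-dec ((u <? p) ×-dec (m ≟ p * u)))

-- u = 0 would make m = 0 even.
specificWith⇒p≤m : ∀ {m p u} → SpecificWith m p u → p ≤ m
specificWith⇒p≤m {p = p} {u = 0} (odd , _ , _ , refl) rewrite ℕ.*-zeroʳ p with odd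
... | ()
specificWith⇒p≤m {p = p} {u = suc u} (_ , _ , _ , refl) = ℕ.m≤m*n p (suc u)

specific? : ∀ m → Dec (Specific m)
specific? m with anyUpTo? (λ p → anyUpTo? (specificWith? m p) p) (suc m)
... | yes (p , _ , u , _ , sw) = yes (p , u , sw)
... | no ∄p = no λ { (p , u , sw@(_ , _ , u<p , _)) →
  ∄p (p , s≤s (specificWith⇒p≤m sw) , u , u<p , sw) }

module _ {A : Set} where

  ∃-++⇒Suffix : ∀ {zs ys : List.List A} → Σ _ (λ xs → ys ≡ xs ++ zs) → Suffix _≡_ zs ys
  ∃-++⇒Suffix (xs , refl) = xs ++ˢ Suffix.here (≡⇒Pointwise-≡ refl)

  Suffix⇒∃-++ : ∀ {zs ys : List.List A} → Suffix _≡_ zs ys → Σ _ (λ xs → ys ≡ xs ++ zs)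
  Suffix⇒∃-++ s with toView s
  ... | xs Suffix.++ eq = xs , cong (xs ++_) (sym (Pointwise-≡⇒≡ eq))

length-replicate-++-∷ : ∀ {A : Set} n (a b : A) xs →
                        length (replicate n a ++ b ∷ xs) ≡ n + suc (length xs)
length-replicate-++-∷ n a b xs rewrite length-++ (replicate n a) {b ∷ xs} | length-replicate n {a} = refl

+≤⇒≤∣∣ : ∀ {n i} → + n ℤ.≤ i → n ≤ ∣ i ∣
+≤⇒≤∣∣ {i = + _} le = ℤ.drop‿+≤+ le

≮⇒≤+∣∣ : ∀ e x G → ¬ ((+ e) ℤ.- G ℤ.< + x) → x ≤ e + ∣ G ∣
≮⇒≤+∣∣ e x G ≮ = ≤-trans (+≤⇒≤∣∣ (ℤ.≮⇒≥ ≮)) (ℤ.∣i-j∣≤∣i∣+∣j∣ (+ e) G)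

module _ (V : Program) (D : ℕ) (G : ℤ) where

  specPadded? : ∀ y → Dec (SpecPadded V D G y)
  specPadded? y with suffix? Bool._≟_ zeros9 y
  ... | no ¬suffix = no λ { (y' , eq , _) → ¬suffix (∃-++⇒Suffix (y' , eq)) }
  ... | yes suffix with Suffix⇒∃-++ suffix
  ...   | y' , eq with specific? (length y')
  ...     | yes s = yes (y' , eq , s)
  ...     | no ¬s = no λ { (y'' , eq' , s) →
    ¬s (subst (λ z → Specific (length z)) (++-cancelʳ zeros9 y'' y' (trans (sym eq') eq)) s) }

  -- Rule 1's side condition branches on whether x is spec-padded, so building
  -- it constructively needs that property to be decidable.
  UOut-rule1 : ∀ {e x} → Out₂ V e [] x → (+ length e) ℤ.- G ℤ.< + length x →
               UOut V D G (replicate (D ∸ 1) true ++ false ∷ e) x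
  UOut-rule1 {e} {x} ve lt with specPadded? x
  ... | yes sp = inj₁ (e , refl , ve , inj₂ (sp , lt))
  ... | no ¬sp = inj₁ (e , refl , ve , inj₁ ¬sp)

  UOut-rule2 : ∀ x → UOut V D G (replicate D true ++ false ∷ x) x
  UOut-rule2 x = inj₂ (inj₁ (x , refl , refl))

  U-description : ∀ {e x} → Out₂ V e [] x →
                  Σ Str λ d → UOut V D G d x × length d ≤ D + suc (length e + ∣ G ∣)
  U-description {e} {x} ve with (+ length e) ℤ.- G ℤ.<? + length x
  ... | yes lt = _ , UOut-rule1 ve lt , bound
    where
    bound : length (replicate (D ∸ 1) true ++ false ∷ e) ≤ D + suc (length e + ∣ G ∣)
    bound rewrite length-replicate-++-∷ (D ∸ 1) true false e =
      +-mono-≤ (ℕ.m∸n≤m D 1) (s≤s (m≤m+n (length e) ∣ G ∣))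
  ... | no ≮ = _ , UOut-rule2 x , bound
    where
    bound : length (replicate D true ++ false ∷ x) ≤ D + suc (length e + ∣ G ∣)
    bound rewrite length-replicate-++-∷ D true false x =
      +-monoʳ-≤ D (s≤s (≮⇒≤+∣∣ (length e) (length x) G ≮))

lemma5 : (V : Program) (D : ℕ) (G : ℤ) →
    UniversalCond V → EvenComplexity V → 0 < D → PaddingConst V D G →
    ∀ (W : Program) → Σ ℕ λ c → ∀ d x → Out₁ W d x →
      Σ Str λ d' → UOut V D G d' x × length d' ≤ length d + c
lemma5 V D G universal _ _ _ W with universal W
... | c , translate = D + suc (c + ∣ G ∣) , describe
  where
  open ℕ.≤-Reasoning

  rearrange : ∀ a b c g → a + suc (b + c + g) ≡ b + (a + suc (c + g))
  rearrange = solve-∀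

  describe : ∀ d x → Out₁ W d x →
             Σ Str λ d' → UOut V D G d' x × length d' ≤ length d + (D + suc (c + ∣ G ∣))
  describe d x wd with translate d [] x wd
  ... | e , ve , e≤d+c with U-description V D G ve
  ...   | d' , ud' , d'≤e+k = d' , ud' , (begin
    length d'                               ≤⟨ d'≤e+k ⟩
    D + suc (length e + ∣ G ∣)              ≤⟨ +-monoʳ-≤ D (s≤s (+-monoˡ-≤ ∣ G ∣ e≤d+c)) ⟩
    D + suc (length d + c + ∣ G ∣)          ≡⟨ rearrange D (length d) c ∣ G ∣ ⟩
    length d + (D + suc (c + ∣ G ∣))        ∎)
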